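{- There is $r_1\in\mathbb{N}$ such that for every integer $r\ge \max\{r_1,10\}$ and every $n$ with $r\le n/4$ the following holds: if $G=(V,W,E)$ is the random bipartite graph with $|V|=|W|=n$ obtained by choosing, independently and uniformly at random for each $v\in V$, a set of $r$ distinct neighbors in $W$, then \[\Pr\left(G \text{ is a } \left(\tfrac{1}{10 r},\tfrac{r}{2}\right)\text{ -expander}\right) \geq \tfrac{8}{9}.\]
   Context: A bipartite graph $G=(V,W,E)$ with $|V|\ge|W|$ is a $(\gamma,\beta)$-expander if every $Y\subseteq V$ with $|Y|\le\gamma|V|$ satisfies $|N(Y)|\ge\beta|Y|$, where $N(Y)=(\bigcup_{v\in Y}N(v))\setminus Y$. -}

module Defs where

open import Data.Nat using (ℕ; _*_; _≤_; _^_)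
open import Data.Nat.Combinatorics using (_C_)
open import Data.Vec using (Vec; []; _∷_)
open import Data.Vec.Relation.Unary.All using (All)
open import Data.Fin.Subset using (Subset; ⊥; _∪_; ∣_∣; inside; outside)
open import Data.Product using (_×_; ∃-syntax)
open import Data.List using (List; length)
import Data.List.Relation.Unary.All as L
open import Data.List.Relation.Unary.Unique.Propositional using (Unique)
open import Relation.Binary.PropositionalEquality using (_≡_)

-- A bipartite graph G = (V, W, E) with V = Fin v, W = Fin w, given by
-- the neighbourhood N(x) ⊆ W of each vertex x ∈ V.
BipGraph : ℕ → ℕ → Set
BipGraph v w = Vec (Subset w) v

-- N(Y) = ⋃_{x ∈ Y} N(x)  (Y ⊆ V, N(Y) ⊆ W; V and W are disjoint so "∖ Y" is vacuous)
Nbhd : ∀ {v w} → BipGraph v w → Subset v → Subset w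
Nbhd []      []            = ⊥
Nbhd (g ∷ G) (inside ∷ Y)  = g ∪ Nbhd G Y
Nbhd (g ∷ G) (outside ∷ Y) = Nbhd G Y

-- (γ, β)-expander with rational γ = γn/γd, β = βn/βd (γd, βd > 0):
-- every Y ⊆ V with |Y| ≤ γ|V| has |N(Y)| ≥ β|Y|.  (Requires |V| ≥ |W|.)
IsExpander : ∀ {v w} → (γn γd βn βd : ℕ) → BipGraph v w → Set
IsExpander {v} {w} γn γd βn βd G =
  w ≤ v × (∀ (Y : Subset v) → γd * ∣ Y ∣ ≤ γn * v → βn * ∣ Y ∣ ≤ βd * ∣ Nbhd G Y ∣)

-- Outcome of the random experiment: each x ∈ V picks an r-subset of W.
-- The sample space (uniform) consists of all G with every neighbourhood of size r;
-- it has exactly (n C r)^n elements.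
RegularLeft : ∀ {v w} → ℕ → BipGraph v w → Set
RegularLeft r G = All (λ s → ∣ s ∣ ≡ r) G

-- Pr(G is a (γ,β)-expander) ≥ p/q, under the uniform distribution on
-- left-r-regular bipartite graphs with |V| = |W| = n: there are at least
-- (p/q)·(n C r)^n distinct outcomes that are expanders.
ProbExpanderAtLeast : (n r γn γd βn βd p q : ℕ) → Set
ProbExpanderAtLeast n r γn γd βn βd p q =
  ∃[ L ] (Unique {A = BipGraph n n} L
          × L.All (λ G → RegularLeft r G × IsExpander γn γd βn βd G) L
          × p * (n C r) ^ n ≤ q * length L)

module Submission where

-- Probabilities are counts: the sample space is the explicit list
-- of all (n C r)^n outcomes.
--
-- A non-expander has a set Y, |Y| = s with 10rs ≤ n, whose neighbourhood
-- has fewer than rs/2 vertices, hence lies in a set T of size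
-- t = ⌊(rs-1)/2⌋.  By the union bound over s and over all pairs (Y,T),
-- the fraction of bad outcomes is at most
--   Σ_{s ≥ 1} C(n,s)·C(n,t)·(C(t,r)/C(n,r))^s  ≤  Σ_{s ≥ 1} 1/(9·2^s)  ≤  1/9.
-- The file first proves the estimate on each summand (first-moment-bound,
-- from C(n,s) ≤ (4n/s)^s, C(t,r)/C(n,r) ≤ (t/n)^r and 5^r ≥ 38400r²),
-- then the counting facts (union bound, enumeration of k-subsets and of
-- graphs, the exact count of graphs with N(Y) ⊆ T), and finally assembles
-- the count of expanders in the module RandomGraph.

open import Defs using (BipGraph; Nbhd; IsExpander; RegularLeft; ProbExpanderAtLeast)

open import Level using (Level)
open import Function using (_∘_)
open import Data.Bool using (Bool; true; false; _∧_; not)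
open import Data.Product using (∃; ∃-syntax; _×_; _,_; proj₁; proj₂)
open import Data.Sum using (inj₁; inj₂)
open import Relation.Binary.PropositionalEquality
open import Relation.Nullary using (¬_; contradiction; yes; no; does; ¬?; _×-dec_)
open import Relation.Nullary.Decidable using (decidable-stable)
open import Relation.Unary using (Decidable)

open import Data.Nat
open import Data.Nat.Properties
open import Data.Nat.Combinatorics using (_C_; nCk+nC[k+1]≡[n+1]C[k+1])
open import Data.Nat.Combinatorics.Base using (_P′_)
open import Data.Nat.ListAction using (sum)
open import Data.Nat.ListAction.Properties using (sum-++)
open import Data.Nat.Tactic.RingSolver using (solve-∀)
open import Algebra.Properties.CommutativeSemigroup *-commutativeSemigroup
  using (interchange; x∙yz≈y∙xz; x∙yz≈yx∙z; xy∙z≈y∙xz; xy∙z≈x∙zy; xy∙z≈xz∙y)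

open import Data.List
  using (List; []; _∷_; _++_; map; length; filter; concatMap; cartesianProductWith; cartesianProduct)
open import Data.List.Properties using (length-++; length-map; map-++)
open import Data.List.Membership.Propositional using (_∈_)
open import Data.List.Membership.Propositional.Properties
  using (∈-map⁺; ∈-map⁻; ∈-++⁺ˡ; ∈-++⁺ʳ; ∈-concat⁺′;
         ∈-cartesianProduct⁺; ∈-cartesianProduct⁻)
open import Data.List.Relation.Unary.Any using (here; there)
import Data.List.Relation.Unary.All as List
import Data.List.Relation.Unary.All.Properties as List
import Data.List.Relation.Unary.AllPairs as AllPairs
open import Data.List.Relation.Unary.Unique.Propositional using (Unique)
import Data.List.Relation.Unary.Unique.Propositional.Properties as Unique
open import Data.Vec using (Vec; []; _∷_)
open import Data.Vec.Properties using (∷-injective; ∷-injectiveʳ)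
import Data.Vec.Relation.Unary.All as Vec
open import Data.Fin.Subset using (Subset; ⊥; _∪_; ∣_∣; inside; outside)
open import Data.Fin.Subset.Properties using (∣p∣≤n; anySubset?)

-- Binomial coefficients by Pascal's rule: the recursion followed by the
-- enumeration of k-subsets below.
binom : ℕ → ℕ → ℕ
binom _       zero    = 1
binom zero    (suc k) = 0
binom (suc n) (suc k) = binom n k + binom n (suc k)

binom≡C : ∀ n k → binom n k ≡ n C k
binom≡C n       zero    = refl
binom≡C zero    (suc k) = refl
binom≡C (suc n) (suc k) =
  trans (cong₂ _+_ (binom≡C n k) (binom≡C n (suc k))) (nCk+nC[k+1]≡[n+1]C[k+1] n k)

binom-pos : ∀ {n k} → k ≤ n → 1 ≤ binom n k
binom-pos {k = zero}          _         = ≤-refl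
binom-pos {suc n} {suc k} (s≤s k≤n) = ≤-trans (binom-pos k≤n) (m≤m+n _ _)

binom-absorb : ∀ n k → suc k * binom (suc n) (suc k) ≡ suc n * binom n k
binom-absorb zero    zero    = refl
binom-absorb zero    (suc k) = *-zeroʳ (suc (suc k))
binom-absorb (suc n) zero    =
  trans (*-identityˡ _) (trans (binom-1 (suc (suc n))) (sym (*-identityʳ _)))
  where
  binom-1 : ∀ n → binom n 1 ≡ n
  binom-1 zero    = refl
  binom-1 (suc n) = cong suc (binom-1 n)
binom-absorb (suc n) (suc k) = begin
  suc (suc k) * (a + b + c)
    ≡⟨ expand k a b c ⟩
  suc k * (a + b) + (a + b) + suc (suc k) * c
    ≡⟨ cong₂ (λ u v → u + (a + b) + v) (binom-absorb n k) (binom-absorb n (suc k)) ⟩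
  suc n * a + (a + b) + suc n * b
    ≡⟨ regroup n a b ⟩
  suc (suc n) * (a + b)
    ∎
  where
  open ≡-Reasoning
  a b c : ℕ
  a = binom n k
  b = binom n (suc k)
  c = binom (suc n) (suc (suc k))
  expand : ∀ k a b c →
    suc (suc k) * (a + b + c) ≡ suc k * (a + b) + (a + b) + suc (suc k) * c
  expand = solve-∀
  regroup : ∀ n a b → suc n * a + (a + b) + suc n * b ≡ suc (suc n) * (a + b)
  regroup = solve-∀

P′-suc : ∀ n k → suc n P′ suc k ≡ suc n * (n P′ k)
P′-suc n zero    = refl
P′-suc n (suc k) = begin
  (n ∸ k) * (suc n P′ suc k)    ≡⟨ cong ((n ∸ k) *_) (P′-suc n k) ⟩
  (n ∸ k) * (suc n * (n P′ k))  ≡⟨ x∙yz≈y∙xz (n ∸ k) (suc n) (n P′ k) ⟩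
  suc n * ((n ∸ k) * (n P′ k))  ∎
  where open ≡-Reasoning

binom*!≡P′ : ∀ n k → binom n k * k ! ≡ n P′ k
binom*!≡P′ n       zero    = refl
binom*!≡P′ zero    (suc k) = cong (_* (0 P′ k)) (sym (0∸n≡0 k))
binom*!≡P′ (suc n) (suc k) = begin
  binom (suc n) (suc k) * (suc k * k !) ≡⟨ x∙yz≈yx∙z (binom (suc n) (suc k)) (suc k) (k !) ⟩
  suc k * binom (suc n) (suc k) * k !   ≡⟨ cong (_* k !) (binom-absorb n k) ⟩
  suc n * binom n k * k !               ≡⟨ *-assoc (suc n) (binom n k) (k !) ⟩
  suc n * (binom n k * k !)             ≡⟨ cong (suc n *_) (binom*!≡P′ n k) ⟩
  suc n * (n P′ k)                      ≡⟨ P′-suc n k ⟨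
  suc n P′ suc k                        ∎
  where open ≡-Reasoning

binom*!≤pow : ∀ n k → binom n k * k ! ≤ n ^ k
binom*!≤pow n k = subst (_≤ n ^ k) (sym (binom*!≡P′ n k)) (P′≤pow k)
  where
  P′≤pow : ∀ k → n P′ k ≤ n ^ k
  P′≤pow zero    = ≤-refl
  P′≤pow (suc k) = *-mono-≤ (m∸n≤m n k) (P′≤pow k)

-- For t ≤ n the ratio C(t,r)/C(n,r) is at most (t/n)^r: factor by factor,
-- (t-i)/(n-i) ≤ t/n.
binom-ratio : ∀ {t n} r → t ≤ n → binom t r * n ^ r ≤ binom n r * t ^ r
binom-ratio {t} {n} r t≤n = *-cancelʳ-≤ _ _ (r !) {{r !≢0}} (begin
  binom t r * n ^ r * r !  ≡⟨ xy∙z≈xz∙y (binom t r) (n ^ r) (r !) ⟩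
  binom t r * r ! * n ^ r  ≡⟨ cong (_* n ^ r) (binom*!≡P′ t r) ⟩
  (t P′ r) * n ^ r         ≤⟨ P′-ratio r ⟩
  (n P′ r) * t ^ r         ≡⟨ cong (_* t ^ r) (binom*!≡P′ n r) ⟨
  binom n r * r ! * t ^ r  ≡⟨ xy∙z≈xz∙y (binom n r) (t ^ r) (r !) ⟨
  binom n r * t ^ r * r !  ∎)
  where
  open ≤-Reasoning
  factor-ratio : ∀ i → (t ∸ i) * n ≤ (n ∸ i) * t
  factor-ratio i = begin
    (t ∸ i) * n    ≡⟨ *-distribʳ-∸ n t i ⟩
    t * n ∸ i * n  ≤⟨ ∸-monoʳ-≤ (t * n) (*-monoʳ-≤ i t≤n) ⟩
    t * n ∸ i * t  ≡⟨ cong (_∸ i * t) (*-comm t n) ⟩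
    n * t ∸ i * t  ≡⟨ *-distribʳ-∸ t n i ⟨
    (n ∸ i) * t    ∎
  P′-ratio : ∀ r → (t P′ r) * n ^ r ≤ (n P′ r) * t ^ r
  P′-ratio zero    = ≤-refl
  P′-ratio (suc r) = begin
    (t ∸ r) * (t P′ r) * (n * n ^ r)   ≡⟨ interchange (t ∸ r) (t P′ r) n (n ^ r) ⟩
    (t ∸ r) * n * ((t P′ r) * n ^ r)   ≤⟨ *-mono-≤ (factor-ratio r) (P′-ratio r) ⟩
    (n ∸ r) * t * ((n P′ r) * t ^ r)   ≡⟨ interchange (n ∸ r) (n P′ r) t (t ^ r) ⟨
    (n ∸ r) * (n P′ r) * (t * t ^ r)   ∎

double-half≤ : ∀ m → 2 * ⌊ m /2⌋ ≤ m
double-half≤ zero          = z≤n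
double-half≤ (suc zero)    = z≤n
double-half≤ (suc (suc m)) =
  subst (_≤ suc (suc m)) (sym (*-suc 2 ⌊ m /2⌋)) (s≤s (s≤s (double-half≤ m)))

≤suc-double-half : ∀ m → m ≤ suc (2 * ⌊ m /2⌋)
≤suc-double-half zero          = z≤n
≤suc-double-half (suc zero)    = s≤s z≤n
≤suc-double-half (suc (suc m)) =
  subst (suc (suc m) ≤_) (cong suc (sym (*-suc 2 ⌊ m /2⌋))) (s≤s (s≤s (≤suc-double-half m)))

half-pred-bounds : ∀ {m} → 1 ≤ m →
                   suc (2 * ⌊ (m ∸ 1) /2⌋) ≤ m × m ≤ 2 * suc ⌊ (m ∸ 1) /2⌋
half-pred-bounds {suc m} _ =
  s≤s (double-half≤ m) , subst (suc m ≤_) (sym (*-suc 2 ⌊ m /2⌋)) (s≤s (≤suc-double-half m))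

double<⇒≤half-pred : ∀ {x m} → 2 * x < m → x ≤ ⌊ (m ∸ 1) /2⌋
double<⇒≤half-pred {x} {m} 2x<m = begin
  x                  ≡⟨ n≡⌊n+n/2⌋ x ⟩
  ⌊ x + x /2⌋        ≡⟨ cong ⌊_/2⌋ (cong (x +_) (+-identityʳ x)) ⟨
  ⌊ 2 * x /2⌋        ≤⟨ ⌊n/2⌋-mono (∸-monoˡ-≤ 1 2x<m) ⟩
  ⌊ (m ∸ 1) /2⌋      ∎
  where open ≤-Reasoning

bernoulli : ∀ k m → m ≤ suc k → suc k ^ m * (suc k ∸ m) ≤ suc k * k ^ m
bernoulli k zero    _         = ≤-reflexive (*-comm 1 (suc k))
bernoulli k (suc m) (s≤s m≤k) = begin
  suc k * suc k ^ m * (k ∸ m)     ≡⟨ xy∙z≈y∙xz (suc k) (suc k ^ m) (k ∸ m) ⟩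
  suc k ^ m * (suc k * (k ∸ m))   ≤⟨ *-monoʳ-≤ (suc k ^ m) one-step ⟩
  suc k ^ m * ((suc k ∸ m) * k)   ≡⟨ *-assoc (suc k ^ m) (suc k ∸ m) k ⟨
  suc k ^ m * (suc k ∸ m) * k     ≤⟨ *-monoˡ-≤ k (bernoulli k m (m≤n⇒m≤1+n m≤k)) ⟩
  suc k * k ^ m * k               ≡⟨ xy∙z≈x∙zy (suc k) (k ^ m) k ⟩
  suc k * (k * k ^ m)             ∎
  where
  open ≤-Reasoning
  -- (k+1)(k-m) ≤ (k+1-m)k, i.e. k - m ≤ k.
  one-step : suc k * (k ∸ m) ≤ (suc k ∸ m) * k
  one-step = begin
    suc k * (k ∸ m)         ≤⟨ +-monoˡ-≤ (k * (k ∸ m)) (m∸n≤m k m) ⟩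
    k + k * (k ∸ m)         ≡⟨ cong (k +_) (*-comm k (k ∸ m)) ⟩
    suc (k ∸ m) * k         ≡⟨ cong (_* k) (+-∸-assoc 1 m≤k) ⟨
    (suc k ∸ m) * k         ∎

succ-pow≤double : ∀ k m → 2 * m ≤ suc k → suc k ^ m ≤ 2 * k ^ m
succ-pow≤double k m 2m≤k+1 = *-cancelʳ-≤ _ _ (suc k ∸ m) {{rest-nonZero}} (begin
  suc k ^ m * (suc k ∸ m)     ≤⟨ bernoulli k m m≤k+1 ⟩
  suc k * k ^ m               ≤⟨ *-monoˡ-≤ (k ^ m) k+1≤2rest ⟩
  2 * (suc k ∸ m) * k ^ m     ≡⟨ xy∙z≈xz∙y 2 (suc k ∸ m) (k ^ m) ⟩
  2 * k ^ m * (suc k ∸ m)     ∎)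
  where
  open ≤-Reasoning
  m≤k+1 : m ≤ suc k
  m≤k+1 = ≤-trans (m≤m+n m (m + 0)) 2m≤k+1
  -- k+1 = m + (k+1-m) ≤ 2(k+1-m), as m ≤ k+1-m.
  k+1≤2rest : suc k ≤ 2 * (suc k ∸ m)
  k+1≤2rest = begin
    suc k                       ≡⟨ m+[n∸m]≡n m≤k+1 ⟨
    m + (suc k ∸ m)             ≤⟨ +-monoˡ-≤ (suc k ∸ m) m≤rest ⟩
    (suc k ∸ m) + (suc k ∸ m)   ≡⟨ cong ((suc k ∸ m) +_) (+-identityʳ (suc k ∸ m)) ⟨
    2 * (suc k ∸ m)             ∎
    where
    m≤rest : m ≤ suc k ∸ m
    m≤rest = +-cancelˡ-≤ m m (suc k ∸ m)
      (subst₂ _≤_ (cong (m +_) (+-identityʳ m)) (sym (m+[n∸m]≡n m≤k+1)) 2m≤k+1)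
  rest-nonZero : NonZero (suc k ∸ m)
  rest-nonZero = >-nonZero (*-cancelˡ-< 2 0 _ (≤-trans (s≤s z≤n) k+1≤2rest))

-- (1 + 1/k)^k ≤ 4: split the exponent into two halves.
succ-pow≤4pow : ∀ k → suc k ^ k ≤ 4 * k ^ k
succ-pow≤4pow k = begin
  suc k ^ k                  ≡⟨ cong (suc k ^_) a+b≡k ⟨
  suc k ^ (a + b)            ≡⟨ ^-distribˡ-+-* (suc k) a b ⟩
  suc k ^ a * suc k ^ b      ≤⟨ *-mono-≤ (succ-pow≤double k a 2a≤k+1)
                                          (succ-pow≤double k b 2b≤k+1) ⟩
  2 * k ^ a * (2 * k ^ b)    ≡⟨ rearrange (k ^ a) (k ^ b) ⟩
  4 * (k ^ a * k ^ b)        ≡⟨ cong (4 *_) (^-distribˡ-+-* k a b) ⟨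
  4 * k ^ (a + b)            ≡⟨ cong (λ e → 4 * k ^ e) a+b≡k ⟩
  4 * k ^ k                  ∎
  where
  open ≤-Reasoning
  rearrange : ∀ x y → 2 * x * (2 * y) ≡ 4 * (x * y)
  rearrange = solve-∀
  a b : ℕ
  a = ⌊ k /2⌋
  b = k ∸ a
  a+b≡k : a + b ≡ k
  a+b≡k = m+[n∸m]≡n (⌊n/2⌋≤n k)
  2a≤k+1 : 2 * a ≤ suc k
  2a≤k+1 = m≤n⇒m≤1+n (double-half≤ k)
  -- 2b + 2a = 2k ≤ k + (2a + 1), using k ≤ 2a + 1.
  2b≤k+1 : 2 * b ≤ suc k
  2b≤k+1 = +-cancelʳ-≤ (2 * a) (2 * b) (suc k) (begin
    2 * b + 2 * a    ≡⟨ *-distribˡ-+ 2 b a ⟨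
    2 * (b + a)      ≡⟨ cong (2 *_) (trans (+-comm b a) a+b≡k) ⟩
    k + (k + 0)      ≡⟨ cong (k +_) (+-identityʳ k) ⟩
    k + k            ≤⟨ +-monoʳ-≤ k (≤suc-double-half k) ⟩
    k + suc (2 * a)  ≡⟨ +-suc k (2 * a) ⟩
    suc k + 2 * a    ∎)

pow-self≤ : ∀ k → k ^ k ≤ 4 ^ k * k !
pow-self≤ zero    = ≤-refl
pow-self≤ (suc k) = begin
  suc k * suc k ^ k              ≤⟨ *-monoʳ-≤ (suc k) (succ-pow≤4pow k) ⟩
  suc k * (4 * k ^ k)            ≤⟨ *-monoʳ-≤ (suc k) (*-monoʳ-≤ 4 (pow-self≤ k)) ⟩
  suc k * (4 * (4 ^ k * k !))    ≡⟨ rearrange (suc k) (4 ^ k) (k !) ⟩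
  4 * 4 ^ k * (suc k * k !)      ∎
  where
  open ≤-Reasoning
  rearrange : ∀ a b c → a * (4 * (b * c)) ≡ 4 * b * (a * c)
  rearrange = solve-∀

binom*pow≤ : ∀ n s → binom n s * s ^ s ≤ 4 ^ s * n ^ s
binom*pow≤ n s = begin
  binom n s * s ^ s            ≤⟨ *-monoʳ-≤ (binom n s) (pow-self≤ s) ⟩
  binom n s * (4 ^ s * s !)    ≡⟨ x∙yz≈y∙xz (binom n s) (4 ^ s) (s !) ⟩
  4 ^ s * (binom n s * s !)    ≤⟨ *-monoʳ-≤ (4 ^ s) (binom*!≤pow n s) ⟩
  4 ^ s * n ^ s                ∎
  where open ≤-Reasoning

*-^-distrib : ∀ a b m → (a * b) ^ m ≡ a ^ m * b ^ m
*-^-distrib a b zero    = refl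
*-^-distrib a b (suc m) = begin
  a * b * (a * b) ^ m       ≡⟨ cong (a * b *_) (*-^-distrib a b m) ⟩
  a * b * (a ^ m * b ^ m)   ≡⟨ interchange a b (a ^ m) (b ^ m) ⟩
  a * a ^ m * (b * b ^ m)   ∎
  where open ≡-Reasoning

square-cancel-≤ : ∀ {a b} → a * a ≤ b * b → a ≤ b
square-cancel-≤ {a} {b} a²≤b² with ≤-<-connex a b
... | inj₁ a≤b = a≤b
... | inj₂ b<a = contradiction a²≤b² (<⇒≱ (*-mono-< b<a b<a))

-- Exponential beats quadratic: 38400·r² ≤ 5^r for r ≥ 12.  Each step
-- r ↦ r+1 multiplies the left side by at most 5 (as (r+1)² ≤ 5r² for r ≥ 1).
quadratic≤pow5 : ∀ r → 12 ≤ r → 38400 * (r * r) ≤ 5 ^ r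
quadratic≤pow5 r 12≤r =
  subst (λ m → 38400 * (m * m) ≤ 5 ^ m) (m+[n∸m]≡n 12≤r) (from12 (r ∸ 12))
  where
  open ≤-Reasoning
  square-step : ∀ q → suc (suc q) * suc (suc q) ≤ 5 * (suc q * suc q)
  square-step q = subst (suc (suc q) * suc (suc q) ≤_) (sym (expand q)) (m≤m+n _ _)
    where
    expand : ∀ q → 5 * (suc q * suc q) ≡ suc (suc q) * suc (suc q) + (4 * (q * q) + 6 * q + 1)
    expand = solve-∀
  from12 : ∀ j → 38400 * ((12 + j) * (12 + j)) ≤ 5 ^ (12 + j)
  from12 zero    = ≤ᵇ⇒≤ (38400 * (12 * 12)) (5 ^ 12) _
  from12 (suc j) = begin
    38400 * ((13 + j) * (13 + j))        ≤⟨ *-monoʳ-≤ 38400 (square-step (11 + j)) ⟩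
    38400 * (5 * ((12 + j) * (12 + j)))  ≡⟨ x∙yz≈y∙xz 38400 5 ((12 + j) * (12 + j)) ⟩
    5 * (38400 * ((12 + j) * (12 + j)))  ≤⟨ *-monoʳ-≤ 5 (from12 j) ⟩
    5 * 5 ^ (12 + j)                     ∎

-- For r ≥ 12, s ≥ 1 and rs ≤ 2(t+1):  9·(80r)^s ≤ 20·5^t.
-- Compare squares: 81·(6400r²)^s ≤ 16·(38400r²)^s ≤ 16·5^(rs) ≤ (20·5^t)².
linear≤pow5 : ∀ {r s t} → 12 ≤ r → 1 ≤ s → r * s ≤ 2 * suc t → 9 * (80 * r) ^ s ≤ 20 * 5 ^ t
linear≤pow5 {r} {s@(suc s-1)} {t} 12≤r _ rs≤2t+2 = square-cancel-≤ (begin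
  9 * (80 * r) ^ s * (9 * (80 * r) ^ s)  ≡⟨ square-9 ((80 * r) ^ s) ⟩
  81 * ((80 * r) ^ s * (80 * r) ^ s)    ≡⟨ cong (81 *_) (*-^-distrib (80 * r) (80 * r) s) ⟨
  81 * (80 * r * (80 * r)) ^ s          ≡⟨ cong (λ x → 81 * x ^ s) (square-80 r) ⟩
  81 * A ^ s                            ≤⟨ *-monoˡ-≤ (A ^ s) (≤ᵇ⇒≤ 81 96 _) ⟩
  96 * A ^ s                            ≡⟨ *-assoc 16 6 (A ^ s) ⟩
  16 * (6 * A ^ s)                      ≤⟨ *-monoʳ-≤ 16 (*-monoˡ-≤ (A ^ s) 6≤6^s) ⟩
  16 * (6 ^ s * A ^ s)                  ≡⟨ cong (16 *_) (*-^-distrib 6 A s) ⟨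
  16 * (6 * A) ^ s                      ≤⟨ *-monoʳ-≤ 16 (^-monoˡ-≤ s 6A≤5^r) ⟩
  16 * (5 ^ r) ^ s                      ≡⟨ cong (16 *_) (^-*-assoc 5 r s) ⟩
  16 * 5 ^ (r * s)                      ≤⟨ *-monoʳ-≤ 16 (^-monoʳ-≤ 5 rs≤2t+2) ⟩
  16 * 5 ^ (2 * suc t)                  ≡⟨ cong (16 *_) (^-*-assoc 5 2 (suc t)) ⟨
  16 * (25 * 25 ^ t)                    ≡⟨ cong (λ x → 16 * (25 * x)) (*-^-distrib 5 5 t) ⟩
  16 * (25 * (5 ^ t * 5 ^ t))           ≡⟨ square-20 (5 ^ t) ⟩
  20 * 5 ^ t * (20 * 5 ^ t)             ∎)
  where
  open ≤-Reasoning
  A : ℕ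
  A = 6400 * (r * r)
  6≤6^s : 6 ≤ 6 ^ s
  6≤6^s = *-monoʳ-≤ 6 (m^n>0 6 s-1)
  6A≤5^r : 6 * A ≤ 5 ^ r
  6A≤5^r = subst (_≤ 5 ^ r) (*-assoc 6 6400 (r * r)) (quadratic≤pow5 r 12≤r)
  square-9 : ∀ x → 9 * x * (9 * x) ≡ 81 * (x * x)
  square-9 = solve-∀
  square-80 : ∀ r → 80 * r * (80 * r) ≡ 6400 * (r * r)
  square-80 = solve-∀
  square-20 : ∀ x → 16 * (25 * (x * x)) ≡ 20 * x * (20 * x)
  square-20 = solve-∀

-- If t+1 ≤ k+s then 9·(80r)^s ≤ 20·5^t yields 9·4^s·4^t·r^s ≤ 20^k
-- (multiply both sides by 20^s).
pow-budget : ∀ {r s t} k → 9 * (80 * r) ^ s ≤ 20 * 5 ^ t → suc t ≤ k + s →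
             9 * 4 ^ s * 4 ^ t * r ^ s ≤ 20 ^ k
pow-budget {r} {s} {t} k small t+1≤k+s = *-cancelʳ-≤ _ _ (20 ^ s) {{m^n≢0 20 s}} (begin
  9 * 4 ^ s * 4 ^ t * r ^ s * 20 ^ s     ≡⟨ regroup (4 ^ s) (4 ^ t) (r ^ s) (20 ^ s) ⟩
  9 * (4 ^ s * r ^ s * 20 ^ s) * 4 ^ t   ≡⟨ cong (λ x → 9 * (x * 20 ^ s) * 4 ^ t) (*-^-distrib 4 r s) ⟨
  9 * ((4 * r) ^ s * 20 ^ s) * 4 ^ t     ≡⟨ cong (λ x → 9 * x * 4 ^ t) (*-^-distrib (4 * r) 20 s) ⟨
  9 * (4 * r * 20) ^ s * 4 ^ t           ≡⟨ cong (λ x → 9 * x ^ s * 4 ^ t) (*-comm (4 * r) 20) ⟩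
  9 * (20 * (4 * r)) ^ s * 4 ^ t         ≡⟨ cong (λ x → 9 * x ^ s * 4 ^ t) (*-assoc 20 4 r) ⟨
  9 * (80 * r) ^ s * 4 ^ t               ≤⟨ *-monoˡ-≤ (4 ^ t) small ⟩
  20 * 5 ^ t * 4 ^ t                     ≡⟨ *-assoc 20 (5 ^ t) (4 ^ t) ⟩
  20 * (5 ^ t * 4 ^ t)                   ≡⟨ cong (20 *_) (*-^-distrib 5 4 t) ⟨
  20 ^ suc t                             ≤⟨ ^-monoʳ-≤ 20 t+1≤k+s ⟩
  20 ^ (k + s)                           ≡⟨ ^-distribˡ-+-* 20 k s ⟩
  20 ^ k * 20 ^ s                        ∎)
  where
  open ≤-Reasoning
  regroup : ∀ a b c d → 9 * a * b * c * d ≡ 9 * (a * c * d) * b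
  regroup = solve-∀

^-distribˡ-+₃ : ∀ m a b c → m ^ (a + b + c) ≡ m ^ a * m ^ b * m ^ c
^-distribˡ-+₃ m a b c = trans (^-distribˡ-+-* m (a + b) c) (cong (_* m ^ c) (^-distribˡ-+-* m a b))

-- Writing rs = s + t + k, it
-- says 9·8^s·4^t·t^s·t^k ≤ s^s·n^k, which follows from 2t ≤ rs (so
-- (2t)^s ≤ r^s·s^s), 20t ≤ n (so 20^k·t^k ≤ n^k) and pow-budget.
power-form : ∀ {n r s t} k → r * s ≡ s + t + k → 20 * t ≤ n → 2 * t ≤ r * s →
             9 * 4 ^ s * 4 ^ t * r ^ s ≤ 20 ^ k →
             9 * 2 ^ s * 4 ^ s * 4 ^ t * n ^ s * n ^ t * t ^ (r * s) ≤ n ^ (r * s) * s ^ s * t ^ t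
power-form {n} {r} {s} {t} k rs≡s+t+k 20t≤n 2t≤rs budget = begin
  9 * 2 ^ s * 4 ^ s * 4 ^ t * n ^ s * n ^ t * t ^ (r * s)
    ≡⟨ cong (λ e → 9 * 2 ^ s * 4 ^ s * 4 ^ t * n ^ s * n ^ t * t ^ e) rs≡s+t+k ⟩
  9 * 2 ^ s * 4 ^ s * 4 ^ t * n ^ s * n ^ t * t ^ (s + t + k)
    ≡⟨ cong (9 * 2 ^ s * 4 ^ s * 4 ^ t * n ^ s * n ^ t *_) (^-distribˡ-+₃ t s t k) ⟩
  9 * 2 ^ s * 4 ^ s * 4 ^ t * n ^ s * n ^ t * (t ^ s * t ^ t * t ^ k)
    ≡⟨ regroup₁ (2 ^ s) (4 ^ s) (4 ^ t) (n ^ s) (n ^ t) (t ^ s) (t ^ t) (t ^ k) ⟩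
  M * F * (2 ^ s * t ^ s) * t ^ k
    ≡⟨ cong (λ x → M * F * x * t ^ k) (*-^-distrib 2 t s) ⟨
  M * F * (2 * t) ^ s * t ^ k
    ≤⟨ *-monoˡ-≤ (t ^ k) (*-monoʳ-≤ (M * F) (^-monoˡ-≤ s 2t≤rs)) ⟩
  M * F * (r * s) ^ s * t ^ k
    ≡⟨ cong (λ x → M * F * x * t ^ k) (*-^-distrib r s s) ⟩
  M * F * (r ^ s * s ^ s) * t ^ k
    ≡⟨ regroup₂ M (4 ^ s) (4 ^ t) (r ^ s) (s ^ s) (t ^ k) ⟩
  M * s ^ s * (9 * 4 ^ s * 4 ^ t * r ^ s * t ^ k)
    ≤⟨ *-monoʳ-≤ (M * s ^ s) (*-monoˡ-≤ (t ^ k) budget) ⟩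
  M * s ^ s * (20 ^ k * t ^ k)
    ≡⟨ cong (M * s ^ s *_) (*-^-distrib 20 t k) ⟨
  M * s ^ s * (20 * t) ^ k
    ≤⟨ *-monoʳ-≤ (M * s ^ s) (^-monoˡ-≤ k 20t≤n) ⟩
  M * s ^ s * n ^ k
    ≡⟨ regroup₃ (n ^ s) (n ^ t) (t ^ t) (s ^ s) (n ^ k) ⟩
  n ^ s * n ^ t * n ^ k * s ^ s * t ^ t
    ≡⟨ cong (λ x → x * s ^ s * t ^ t) (^-distribˡ-+₃ n s t k) ⟨
  n ^ (s + t + k) * s ^ s * t ^ t
    ≡⟨ cong (λ e → n ^ e * s ^ s * t ^ t) rs≡s+t+k ⟨
  n ^ (r * s) * s ^ s * t ^ t
    ∎
  where
  open ≤-Reasoning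
  M F : ℕ
  M = n ^ s * n ^ t * t ^ t
  F = 9 * 4 ^ s * 4 ^ t
  regroup₁ : ∀ a b c d e f g h →
    9 * a * b * c * d * e * (f * g * h) ≡ d * e * g * (9 * b * c) * (a * f) * h
  regroup₁ = solve-∀
  regroup₂ : ∀ m b c d e h → m * (9 * b * c) * (d * e) * h ≡ m * e * (9 * b * c * d * h)
  regroup₂ = solve-∀
  regroup₃ : ∀ a b c d e → a * b * c * d * e ≡ a * b * e * d * c
  regroup₃ = solve-∀

binom-ratio-pow : ∀ {t n} r s → t ≤ n → binom t r ^ s * n ^ (r * s) ≤ binom n r ^ s * t ^ (r * s)
binom-ratio-pow {t} {n} r s t≤n = begin
  binom t r ^ s * n ^ (r * s)   ≡⟨ cong (binom t r ^ s *_) (^-*-assoc n r s) ⟨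
  binom t r ^ s * (n ^ r) ^ s   ≡⟨ *-^-distrib (binom t r) (n ^ r) s ⟨
  (binom t r * n ^ r) ^ s       ≤⟨ ^-monoˡ-≤ s (binom-ratio r t≤n) ⟩
  (binom n r * t ^ r) ^ s       ≡⟨ *-^-distrib (binom n r) (t ^ r) s ⟩
  binom n r ^ s * (t ^ r) ^ s   ≡⟨ cong (binom n r ^ s *_) (^-*-assoc t r s) ⟩
  binom n r ^ s * t ^ (r * s)   ∎
  where open ≤-Reasoning

-- a^a ≠ 0 (with 0^0 = 1).
pow-self-nonZero : ∀ a → NonZero (a ^ a)
pow-self-nonZero zero    = _
pow-self-nonZero (suc a) = m^n≢0 (suc a) (suc a)

-- For r ≥ 12 and 2t < rs ≤ 2(t+1) the exponent rs splits as s + t + k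
-- with t + 1 ≤ k + s: from 12s ≤ rs ≤ 2(t+1) we get s ≤ t + 1, so
-- s + t ≤ 2t + 1 ≤ rs, and k = rs - s - t ≥ t + 1 - s.
exponent-split : ∀ {r s t} → 12 ≤ r → suc (2 * t) ≤ r * s → r * s ≤ 2 * suc t →
                 ∃[ k ] (r * s ≡ s + t + k × suc t ≤ k + s)
exponent-split {r} {s} {t} 12≤r 2t<rs rs≤2t+2 = k , rs≡s+t+k , t+1≤k+s
  where
  open ≤-Reasoning
  s≤t+1 : s ≤ suc t
  s≤t+1 = *-cancelˡ-≤ 2 (begin
    2 * s            ≤⟨ m≤m+n (2 * s) (10 * s) ⟩
    2 * s + 10 * s   ≡⟨ *-distribʳ-+ s 2 10 ⟨
    12 * s           ≤⟨ *-monoˡ-≤ s 12≤r ⟩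
    r * s            ≤⟨ rs≤2t+2 ⟩
    2 * suc t        ∎)
  s+t≤rs : s + t ≤ r * s
  s+t≤rs = begin
    s + t            ≤⟨ +-monoˡ-≤ t s≤t+1 ⟩
    suc t + t        ≡⟨ cong suc (cong (t +_) (+-identityʳ t)) ⟨
    suc (2 * t)      ≤⟨ 2t<rs ⟩
    r * s            ∎
  k : ℕ
  k = r * s ∸ (s + t)
  rs≡s+t+k : r * s ≡ s + t + k
  rs≡s+t+k = sym (m+[n∸m]≡n s+t≤rs)
  t+1≤k+s : suc t ≤ k + s
  t+1≤k+s = +-cancelʳ-≤ t (suc t) (k + s) (begin
    suc t + t        ≡⟨ cong suc (cong (t +_) (+-identityʳ t)) ⟨
    suc (2 * t)      ≤⟨ 2t<rs ⟩
    r * s            ≡⟨ rs≡s+t+k ⟩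
    s + t + k        ≡⟨ rotate s t k ⟩
    k + s + t        ∎)
    where
    rotate : ∀ s t k → s + t + k ≡ k + s + t
    rotate = solve-∀

-- Fix s ≥ 1 with 10rs ≤ n and t with
-- 2t < rs ≤ 2t + 2.  Choosing an s-set Y ⊆ V, a t-set T ⊆ W and asking
-- that all s random r-sets fall into T has expected count
-- C(n,s)·C(n,t)·(C(t,r)/C(n,r))^s, and this is at most 1/(9·2^s).
first-moment-bound : ∀ {n r s t} → 12 ≤ r → 1 ≤ s →
                     suc (2 * t) ≤ r * s → r * s ≤ 2 * suc t → 10 * (r * s) ≤ n →
                     9 * 2 ^ s * binom n s * binom n t * binom t r ^ s ≤ binom n r ^ s
first-moment-bound {n} {r} {s} {t} 12≤r 1≤s 2t<rs rs≤2t+2 10rs≤n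
  with k , rs≡s+t+k , t+1≤k+s ← exponent-split 12≤r 2t<rs rs≤2t+2 =
  *-cancelʳ-≤ _ _ Q {{Q-nonZero}} (begin
    9 * 2 ^ s * binom n s * binom n t * binom t r ^ s * Q
      ≡⟨ regroup₁ (2 ^ s) (binom n s) (binom n t) (binom t r ^ s) (n ^ (r * s)) (s ^ s) (t ^ t) ⟩
    9 * 2 ^ s * (binom n s * s ^ s) * (binom n t * t ^ t) * (binom t r ^ s * n ^ (r * s))
      ≤⟨ *-mono-≤ (*-mono-≤ (*-monoʳ-≤ (9 * 2 ^ s) (binom*pow≤ n s)) (binom*pow≤ n t))
                  (binom-ratio-pow r s t≤n) ⟩
    9 * 2 ^ s * (4 ^ s * n ^ s) * (4 ^ t * n ^ t) * (binom n r ^ s * t ^ (r * s))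
      ≡⟨ regroup₂ (2 ^ s) (4 ^ s) (n ^ s) (4 ^ t) (n ^ t) (binom n r ^ s) (t ^ (r * s)) ⟩
    binom n r ^ s * (9 * 2 ^ s * 4 ^ s * 4 ^ t * n ^ s * n ^ t * t ^ (r * s))
      ≤⟨ *-monoʳ-≤ (binom n r ^ s) (power-form {n} {r} k rs≡s+t+k 20t≤n 2t≤rs
           (pow-budget {r} k (linear≤pow5 12≤r 1≤s rs≤2t+2) t+1≤k+s)) ⟩
    binom n r ^ s * Q
      ∎)
  where
  open ≤-Reasoning
  Q : ℕ
  Q = n ^ (r * s) * s ^ s * t ^ t
  regroup₁ : ∀ a b c d e f g →
    9 * a * b * c * d * (e * f * g) ≡ 9 * a * (b * f) * (c * g) * (d * e)
  regroup₁ = solve-∀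
  regroup₂ : ∀ a b c d e f g →
    9 * a * (b * c) * (d * e) * (f * g) ≡ f * (9 * a * b * d * c * e * g)
  regroup₂ = solve-∀
  20t≤n : 20 * t ≤ n
  20t≤n = ≤-trans (m≤m+n (20 * t) 10) (≤-trans (≤-reflexive (sym (ten-times t)))
                    (≤-trans (*-monoʳ-≤ 10 2t<rs) 10rs≤n))
    where
    ten-times : ∀ t → 10 * suc (2 * t) ≡ 20 * t + 10
    ten-times = solve-∀
  t≤n : t ≤ n
  t≤n = ≤-trans (m≤n*m t 20) 20t≤n
  2t≤rs : 2 * t ≤ r * s
  2t≤rs = ≤-trans (n≤1+n _) 2t<rs
  Q-nonZero : NonZero Q
  Q-nonZero = m*n≢0 (n ^ (r * s) * s ^ s) (t ^ t)
    {{m*n≢0 (n ^ (r * s)) (s ^ s) {{m^n≢0 n (r * s) {{n-nonZero}}}} {{pow-self-nonZero s}}}}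
    {{pow-self-nonZero t}}
    where
    n-nonZero : NonZero n
    n-nonZero = >-nonZero (≤-trans (≤-trans (s≤s z≤n) 2t<rs) (≤-trans (m≤n*m (r * s) 10) 10rs≤n))

private variable
  a b : Level
  A B : Set a

indicator : Bool → ℕ
indicator true  = 1
indicator false = 0

count : (A → Bool) → List A → ℕ
count p []       = 0
count p (x ∷ xs) = indicator (p x) + count p xs

count-++ : ∀ (p : A → Bool) xs ys → count p (xs ++ ys) ≡ count p xs + count p ys
count-++ p []       ys = refl
count-++ p (x ∷ xs) ys = trans (cong (indicator (p x) +_) (count-++ p xs ys))
                               (sym (+-assoc (indicator (p x)) (count p xs) (count p ys)))

count-map : ∀ (p : B → Bool) (f : A → B) xs → count p (map f xs) ≡ count (p ∘ f) xs
count-map p f []       = refl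
count-map p f (x ∷ xs) = cong (indicator (p (f x)) +_) (count-map p f xs)

count-cong : ∀ {p q : A → Bool} → (∀ x → p x ≡ q x) → ∀ xs → count p xs ≡ count q xs
count-cong p≗q []       = refl
count-cong p≗q (x ∷ xs) = cong₂ _+_ (cong indicator (p≗q x)) (count-cong p≗q xs)

count-const-true : ∀ (xs : List A) → count (λ _ → true) xs ≡ length xs
count-const-true []       = refl
count-const-true (x ∷ xs) = cong suc (count-const-true xs)

count-const-false : ∀ (xs : List A) → count (λ _ → false) xs ≡ 0
count-const-false []       = refl
count-const-false (x ∷ xs) = count-const-false xs

count+count-not : ∀ (p : A → Bool) xs → count p xs + count (λ x → not (p x)) xs ≡ length xs
count+count-not p []       = refl
count+count-not p (x ∷ xs) with p x
... | true  = cong suc (count+count-not p xs)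
... | false = trans (+-suc (count p xs) _) (cong suc (count+count-not p xs))

∈⇒≤sum : ∀ (f : A → ℕ) {i I} → i ∈ I → f i ≤ sum (map f I)
∈⇒≤sum f (here refl) = m≤m+n _ _
∈⇒≤sum f {I = j ∷ I} (there i∈I) = ≤-trans (∈⇒≤sum f i∈I) (m≤n+m _ (f j))

sum-map-+ : ∀ (f g : A → ℕ) I → sum (map (λ i → f i + g i) I) ≡ sum (map f I) + sum (map g I)
sum-map-+ f g []      = refl
sum-map-+ f g (i ∷ I) = trans (cong (f i + g i +_) (sum-map-+ f g I))
                              (interchange-+ (f i) (g i) (sum (map f I)) (sum (map g I)))
  where
  interchange-+ : ∀ a b c d → a + b + (c + d) ≡ a + c + (b + d)
  interchange-+ = solve-∀

sum-map-*ˡ : ∀ c (f : A → ℕ) I → c * sum (map f I) ≡ sum (map (λ i → c * f i) I)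
sum-map-*ˡ c f []      = *-zeroʳ c
sum-map-*ˡ c f (i ∷ I) = trans (*-distribˡ-+ c (f i) _) (cong (c * f i +_) (sum-map-*ˡ c f I))

sum-map-const : ∀ (f : A → ℕ) b I → (∀ {i} → i ∈ I → f i ≡ b) →
                sum (map f I) ≡ length I * b
sum-map-const f b []      _     = refl
sum-map-const f b (i ∷ I) f≡b = cong₂ _+_ (f≡b (here refl)) (sum-map-const f b I (f≡b ∘ there))

sum-concatMap : (g : A → ℕ) (f : B → List A) (R : List B) →
                sum (map g (concatMap f R)) ≡ sum (map (λ s → sum (map g (f s))) R)
sum-concatMap g f []      = refl
sum-concatMap g f (s ∷ R) =
  trans (trans (cong sum (map-++ g (f s) _)) (sum-++ (map g (f s)) _))
        (cong (sum (map g (f s)) +_) (sum-concatMap g f R))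

union-bound : (p : A → Bool) (q : B → A → Bool) (I : List B) →
              (∀ x → p x ≡ true → ∃[ i ] (i ∈ I × q i x ≡ true)) →
              ∀ xs → count p xs ≤ sum (map (λ i → count (q i) xs) I)
union-bound p q I cover []       = z≤n
union-bound p q I cover (x ∷ xs) = begin
  indicator (p x) + count p xs
    ≤⟨ +-mono-≤ head-bound (union-bound p q I cover xs) ⟩
  sum (map (λ i → indicator (q i x)) I) + sum (map (λ i → count (q i) xs) I)
    ≡⟨ sum-map-+ (λ i → indicator (q i x)) (λ i → count (q i) xs) I ⟨
  sum (map (λ i → count (q i) (x ∷ xs)) I)
    ∎
  where
  open ≤-Reasoning
  head-bound : indicator (p x) ≤ sum (map (λ i → indicator (q i x)) I)
  head-bound with p x in px
  ... | false = z≤n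
  ... | true with cover x px
  ...   | i , i∈I , qix = subst (_≤ sum (map (λ i → indicator (q i x)) I)) (cong indicator qix)
                                (∈⇒≤sum (λ i → indicator (q i x)) i∈I)

range : ℕ → ℕ → List ℕ
range a zero    = []
range a (suc k) = a ∷ range (suc a) k

∈-range : ∀ {a s} k → a ≤ s → s < a + k → s ∈ range a k
∈-range {a} {s} zero    a≤s s<a+0 = contradiction (subst (s <_) (+-identityʳ a) s<a+0) (≤⇒≯ a≤s)
∈-range {a} {s} (suc k) a≤s s<a+k with m≤n⇒m<n∨m≡n a≤s
... | inj₂ refl = here refl
... | inj₁ a<s  = there (∈-range k a<s (subst (s <_) (+-suc a k) s<a+k))

geometric-sum : ∀ (f : ℕ → ℕ) M a k → (∀ s → a ≤ s → 2 ^ s * f s ≤ M) →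
                2 ^ a * sum (map f (range a k)) ≤ 2 * M
geometric-sum f M a zero    bound = subst (_≤ 2 * M) (sym (*-zeroʳ (2 ^ a))) z≤n
geometric-sum f M a (suc k) bound = begin
  2 ^ a * (f a + S)          ≡⟨ *-distribˡ-+ (2 ^ a) (f a) S ⟩
  2 ^ a * f a + 2 ^ a * S    ≤⟨ +-mono-≤ (bound a ≤-refl) tail-bound ⟩
  M + M                      ≡⟨ cong (M +_) (+-identityʳ M) ⟨
  2 * M                      ∎
  where
  open ≤-Reasoning
  S : ℕ
  S = sum (map f (range (suc a) k))
  tail-bound : 2 ^ a * S ≤ M
  tail-bound = *-cancelˡ-≤ 2 (subst (_≤ 2 * M) (*-assoc 2 (2 ^ a) S)
                 (geometric-sum f M (suc a) k (λ s a<s → bound s (<⇒≤ a<s))))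

subsetsOfSize : (n k : ℕ) → List (Subset n)
subsetsOfSize zero    zero    = [] ∷ []
subsetsOfSize zero    (suc k) = []
subsetsOfSize (suc n) zero    = map (outside ∷_) (subsetsOfSize n zero)
subsetsOfSize (suc n) (suc k) = map (outside ∷_) (subsetsOfSize n (suc k))
                             ++ map (inside ∷_) (subsetsOfSize n k)

length-subsetsOfSize : ∀ n k → length (subsetsOfSize n k) ≡ binom n k
length-subsetsOfSize zero    zero    = refl
length-subsetsOfSize zero    (suc k) = refl
length-subsetsOfSize (suc n) zero    =
  trans (length-map (outside ∷_) (subsetsOfSize n zero)) (length-subsetsOfSize n zero)
length-subsetsOfSize (suc n) (suc k) = begin
  length (map (outside ∷_) (subsetsOfSize n (suc k)) ++ map (inside ∷_) (subsetsOfSize n k))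
    ≡⟨ length-++ (map (outside ∷_) (subsetsOfSize n (suc k))) ⟩
  length (map (outside ∷_) (subsetsOfSize n (suc k))) + length (map (inside ∷_) (subsetsOfSize n k))
    ≡⟨ cong₂ _+_ (length-map (outside ∷_) (subsetsOfSize n (suc k)))
                 (length-map (inside ∷_) (subsetsOfSize n k)) ⟩
  length (subsetsOfSize n (suc k)) + length (subsetsOfSize n k)
    ≡⟨ cong₂ _+_ (length-subsetsOfSize n (suc k)) (length-subsetsOfSize n k) ⟩
  binom n (suc k) + binom n k
    ≡⟨ +-comm (binom n (suc k)) (binom n k) ⟩
  binom n k + binom n (suc k)
    ∎
  where open ≡-Reasoning

-- No subset is listed twice: the two halves differ in the first element.
unique-subsetsOfSize : ∀ n k → Unique (subsetsOfSize n k)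
unique-subsetsOfSize zero    zero    = List.[] AllPairs.∷ AllPairs.[]
unique-subsetsOfSize zero    (suc k) = AllPairs.[]
unique-subsetsOfSize (suc n) zero    = Unique.map⁺ ∷-injectiveʳ (unique-subsetsOfSize n zero)
unique-subsetsOfSize (suc n) (suc k) =
  Unique.++⁺ (Unique.map⁺ ∷-injectiveʳ (unique-subsetsOfSize n (suc k)))
             (Unique.map⁺ ∷-injectiveʳ (unique-subsetsOfSize n k))
             different-heads
  where
  different-heads : ∀ {Y} → ¬ (Y ∈ map (outside ∷_) (subsetsOfSize n (suc k))
                             × Y ∈ map (inside ∷_) (subsetsOfSize n k))
  different-heads (Y∈₁ , Y∈₂) with ∈-map⁻ (outside ∷_) Y∈₁ | ∈-map⁻ (inside ∷_) Y∈₂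
  ... | _ , _ , refl | _ , _ , ()

size-subsetsOfSize : ∀ n k → List.All (λ Y → ∣ Y ∣ ≡ k) (subsetsOfSize n k)
size-subsetsOfSize zero    zero    = refl List.∷ List.[]
size-subsetsOfSize zero    (suc k) = List.[]
size-subsetsOfSize (suc n) zero    = List.map⁺ (size-subsetsOfSize n zero)
size-subsetsOfSize (suc n) (suc k) =
  List.++⁺ (List.map⁺ (size-subsetsOfSize n (suc k)))
           (List.map⁺ (List.map (cong suc) (size-subsetsOfSize n k)))

∈-subsetsOfSize : ∀ {n} (Y : Subset n) → Y ∈ subsetsOfSize n ∣ Y ∣
∈-subsetsOfSize []            = here refl
∈-subsetsOfSize {suc n} (outside ∷ Y) with ∣ Y ∣ | ∈-subsetsOfSize Y
... | zero  | Y∈ = ∈-map⁺ (outside ∷_) Y∈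
... | suc k | Y∈ = ∈-++⁺ˡ (∈-map⁺ (outside ∷_) Y∈)
∈-subsetsOfSize {suc n} (inside ∷ Y) =
  ∈-++⁺ʳ (map (outside ∷_) (subsetsOfSize n (suc ∣ Y ∣)))
         (∈-map⁺ (inside ∷_) (∈-subsetsOfSize Y))

infix 7 _⊆ᵇ_
_⊆ᵇ_ : ∀ {n} → Subset n → Subset n → Bool
[]            ⊆ᵇ []           = true
(outside ∷ S) ⊆ᵇ (_ ∷ T)      = S ⊆ᵇ T
(inside ∷ S)  ⊆ᵇ (inside ∷ T) = S ⊆ᵇ T
(inside ∷ S)  ⊆ᵇ (outside ∷ T) = false

⊥⊆ᵇ : ∀ {n} (T : Subset n) → ⊥ ⊆ᵇ T ≡ true
⊥⊆ᵇ []      = refl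
⊥⊆ᵇ (_ ∷ T) = ⊥⊆ᵇ T

∪⊆ᵇ : ∀ {n} (S S′ T : Subset n) → (S ∪ S′) ⊆ᵇ T ≡ S ⊆ᵇ T ∧ S′ ⊆ᵇ T
∪⊆ᵇ []            []             []            = refl
∪⊆ᵇ (outside ∷ S) (outside ∷ S′) (_ ∷ T)       = ∪⊆ᵇ S S′ T
∪⊆ᵇ (outside ∷ S) (inside ∷ S′)  (inside ∷ T)  = ∪⊆ᵇ S S′ T
∪⊆ᵇ (outside ∷ S) (inside ∷ S′)  (outside ∷ T) with S ⊆ᵇ T
... | true  = refl
... | false = refl
∪⊆ᵇ (inside ∷ S)  (outside ∷ S′) (inside ∷ T)  = ∪⊆ᵇ S S′ T
∪⊆ᵇ (inside ∷ S)  (inside ∷ S′)  (inside ∷ T)  = ∪⊆ᵇ S S′ T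
∪⊆ᵇ (inside ∷ S)  (_ ∷ S′)       (outside ∷ T) = refl

count-subsetsOfSize-suc : ∀ {n} (p : Subset (suc n) → Bool) k →
  count p (subsetsOfSize (suc n) (suc k))
    ≡ count (p ∘ (outside ∷_)) (subsetsOfSize n (suc k)) + count (p ∘ (inside ∷_)) (subsetsOfSize n k)
count-subsetsOfSize-suc {n} p k = begin
  count p (Outside ++ Inside)      ≡⟨ count-++ p Outside Inside ⟩
  count p Outside + count p Inside ≡⟨ cong₂ _+_ (count-map p (outside ∷_) (subsetsOfSize n (suc k)))
                                               (count-map p (inside ∷_) (subsetsOfSize n k)) ⟩
  count (p ∘ (outside ∷_)) (subsetsOfSize n (suc k)) + count (p ∘ (inside ∷_)) (subsetsOfSize n k) ∎
  where
  open ≡-Reasoning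
  Outside Inside : List (Subset (suc n))
  Outside = map (outside ∷_) (subsetsOfSize n (suc k))
  Inside  = map (inside ∷_) (subsetsOfSize n k)

count-⊆ᵇ : ∀ n k (T : Subset n) → count (_⊆ᵇ T) (subsetsOfSize n k) ≡ binom ∣ T ∣ k
count-⊆ᵇ zero    zero    []            = refl
count-⊆ᵇ zero    (suc k) []            = refl
count-⊆ᵇ (suc n) zero    (x ∷ T)       =
  trans (count-map (_⊆ᵇ (x ∷ T)) (outside ∷_) (subsetsOfSize n zero)) (count-⊆ᵇ n zero T)
count-⊆ᵇ (suc n) (suc k) (outside ∷ T) = begin
  count (_⊆ᵇ (outside ∷ T)) (subsetsOfSize (suc n) (suc k))
    ≡⟨ count-subsetsOfSize-suc (_⊆ᵇ (outside ∷ T)) k ⟩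
  count (_⊆ᵇ T) (subsetsOfSize n (suc k)) + count (λ _ → false) (subsetsOfSize n k)
    ≡⟨ cong₂ _+_ (count-⊆ᵇ n (suc k) T) (count-const-false (subsetsOfSize n k)) ⟩
  binom (∣ T ∣) (suc k) + 0
    ≡⟨ +-identityʳ _ ⟩
  binom (∣ T ∣) (suc k)
    ∎
  where open ≡-Reasoning
count-⊆ᵇ (suc n) (suc k) (inside ∷ T) = begin
  count (_⊆ᵇ (inside ∷ T)) (subsetsOfSize (suc n) (suc k))
    ≡⟨ count-subsetsOfSize-suc (_⊆ᵇ (inside ∷ T)) k ⟩
  count (_⊆ᵇ T) (subsetsOfSize n (suc k)) + count (_⊆ᵇ T) (subsetsOfSize n k)
    ≡⟨ cong₂ _+_ (count-⊆ᵇ n (suc k) T) (count-⊆ᵇ n k T) ⟩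
  binom (∣ T ∣) (suc k) + binom (∣ T ∣) k
    ≡⟨ +-comm (binom (∣ T ∣) (suc k)) _ ⟩
  binom (∣ T ∣) k + binom (∣ T ∣) (suc k)
    ∎
  where open ≡-Reasoning

extend : ∀ {n} (S : Subset n) {k} → ∣ S ∣ ≤ k → k ≤ n →
         ∃[ T ] (S ⊆ᵇ T ≡ true × ∣ T ∣ ≡ k)
extend []            {zero}  _         _         = [] , refl , refl
extend (inside ∷ S)  {suc k} (s≤s S≤k) (s≤s k≤n) with extend S S≤k k≤n
... | T , S⊆T , ∣T∣≡k = inside ∷ T , S⊆T , cong suc ∣T∣≡k
extend {suc n} (outside ∷ S) {k} S≤k k≤n+1 with k ≤? n
... | yes k≤n with extend S S≤k k≤n
...   | T , S⊆T , ∣T∣≡k = outside ∷ T , S⊆T , ∣T∣≡k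
extend {suc n} (outside ∷ S) {k} S≤k k≤n+1 | no k≰n with extend S (∣p∣≤n S) ≤-refl
...   | T , S⊆T , ∣T∣≡n =
  inside ∷ T , S⊆T , trans (cong suc ∣T∣≡n) (≤-antisym (≰⇒> k≰n) k≤n+1)

vectors : List A → (m : ℕ) → List (Vec A m)
vectors B zero    = [] ∷ []
vectors B (suc m) = cartesianProductWith _∷_ B (vectors B m)

length-cartesianProductWith : ∀ {c} {C : Set c} (f : A → B → C) xs ys →
  length (cartesianProductWith f xs ys) ≡ length xs * length ys
length-cartesianProductWith f []       ys = refl
length-cartesianProductWith f (x ∷ xs) ys =
  trans (length-++ (map (f x) ys)) (cong₂ _+_ (length-map (f x) ys) (length-cartesianProductWith f xs ys))

length-vectors : ∀ (B : List A) m → length (vectors B m) ≡ length B ^ m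
length-vectors B zero    = refl
length-vectors B (suc m) =
  trans (length-cartesianProductWith _∷_ B (vectors B m)) (cong (length B *_) (length-vectors B m))

unique-vectors : ∀ {B : List A} m → Unique B → Unique (vectors B m)
unique-vectors zero    _        = List.[] AllPairs.∷ AllPairs.[]
unique-vectors (suc m) unique-B =
  Unique.cartesianProductWith⁺ _∷_ ∷-injective unique-B (unique-vectors m unique-B)

all-vectors : ∀ {ℓ} {P : A → Set ℓ} {B : List A} m →
              List.All P B → List.All (Vec.All P) (vectors B m)
all-vectors zero    _   = Vec.[] List.∷ List.[]
all-vectors {P = P} {B} (suc m) all-B =
  List.cartesianProductWith⁺ (setoid _) (setoid _) _∷_ B (vectors B m)
    (λ x∈B xs∈ → List.lookup all-B x∈B Vec.∷ List.lookup (all-vectors m all-B) xs∈)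

count-cartesianProduct : ∀ {m} (p : Vec A (suc m) → Bool) (f : A → Bool) (g : Vec A m → Bool) →
  (∀ x xs → p (x ∷ xs) ≡ f x ∧ g xs) →
  ∀ B ys → count p (cartesianProductWith _∷_ B ys) ≡ count f B * count g ys
count-cartesianProduct p f g split []      ys = refl
count-cartesianProduct p f g split (x ∷ B) ys = begin
  count p (map (x ∷_) ys ++ cartesianProductWith _∷_ B ys)
    ≡⟨ count-++ p (map (x ∷_) ys) _ ⟩
  count p (map (x ∷_) ys) + count p (cartesianProductWith _∷_ B ys)
    ≡⟨ cong₂ _+_ (trans (count-map p (x ∷_) ys) (count-cong (split x) ys))
                 (count-cartesianProduct p f g split B ys) ⟩
  count (λ xs → f x ∧ g xs) ys + count f B * count g ys
    ≡⟨ cong (_+ count f B * count g ys) (count-∧ (f x)) ⟩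
  indicator (f x) * count g ys + count f B * count g ys
    ≡⟨ *-distribʳ-+ (count g ys) (indicator (f x)) (count f B) ⟨
  (indicator (f x) + count f B) * count g ys
    ∎
  where
  open ≡-Reasoning
  count-∧ : ∀ b → count (λ xs → b ∧ g xs) ys ≡ indicator b * count g ys
  count-∧ true  = sym (+-identityʳ (count g ys))
  count-∧ false = count-const-false ys

-- Among the graphs whose neighbourhoods are drawn from B, count those with
-- N(Y) ⊆ T: each vertex of Y has c = #{g ∈ B : g ⊆ T} choices and every
-- other vertex has D = |B|, so the count is c^|Y|·D^(m-|Y|).
count-Nbhd⊆ : ∀ {w} (B : List (Subset w)) (T : Subset w) m (Y : Subset m) →
  count (λ G → Nbhd G Y ⊆ᵇ T) (vectors B m) * length B ^ ∣ Y ∣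
    ≡ count (_⊆ᵇ T) B ^ ∣ Y ∣ * length B ^ m
count-Nbhd⊆ B T zero    []           = cong (λ b → (indicator b + 0) * 1) (⊥⊆ᵇ T)
count-Nbhd⊆ {w} B T (suc m) (outside ∷ Y) = begin
  count p (cartesianProductWith _∷_ B (vectors B m)) * D ^ ∣ Y ∣
    ≡⟨ cong (_* D ^ ∣ Y ∣)
            (count-cartesianProduct p (λ _ → true) q (λ _ _ → refl) B (vectors B m)) ⟩
  count (λ _ → true) B * count q (vectors B m) * D ^ ∣ Y ∣
    ≡⟨ cong (λ x → x * count q (vectors B m) * D ^ ∣ Y ∣) (count-const-true B) ⟩
  D * count q (vectors B m) * D ^ ∣ Y ∣
    ≡⟨ *-assoc D _ _ ⟩
  D * (count q (vectors B m) * D ^ ∣ Y ∣)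
    ≡⟨ cong (D *_) (count-Nbhd⊆ B T m Y) ⟩
  D * (c ^ ∣ Y ∣ * D ^ m)
    ≡⟨ x∙yz≈y∙xz D (c ^ ∣ Y ∣) (D ^ m) ⟩
  c ^ ∣ Y ∣ * (D * D ^ m)
    ∎
  where
  open ≡-Reasoning
  D c : ℕ
  D = length B
  c = count (_⊆ᵇ T) B
  p : BipGraph (suc m) w → Bool
  p G = Nbhd G (outside ∷ Y) ⊆ᵇ T
  q : BipGraph m w → Bool
  q G = Nbhd G Y ⊆ᵇ T
count-Nbhd⊆ {w} B T (suc m) (inside ∷ Y) = begin
  count p (cartesianProductWith _∷_ B (vectors B m)) * (D * D ^ ∣ Y ∣)
    ≡⟨ cong (_* (D * D ^ ∣ Y ∣))
            (count-cartesianProduct p (_⊆ᵇ T) q (λ g G → ∪⊆ᵇ g (Nbhd G Y) T) B (vectors B m)) ⟩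
  c * count q (vectors B m) * (D * D ^ ∣ Y ∣)
    ≡⟨ interchange c (count q (vectors B m)) D (D ^ ∣ Y ∣) ⟩
  c * D * (count q (vectors B m) * D ^ ∣ Y ∣)
    ≡⟨ cong (c * D *_) (count-Nbhd⊆ B T m Y) ⟩
  c * D * (c ^ ∣ Y ∣ * D ^ m)
    ≡⟨ interchange c D (c ^ ∣ Y ∣) (D ^ m) ⟩
  c * c ^ ∣ Y ∣ * (D * D ^ m)
    ∎
  where
  open ≡-Reasoning
  D c : ℕ
  D = length B
  c = count (_⊆ᵇ T) B
  p : BipGraph (suc m) w → Bool
  p G = Nbhd G (inside ∷ Y) ⊆ᵇ T
  q : BipGraph m w → Bool
  q G = Nbhd G Y ⊆ᵇ T

length-filter≡count : ∀ {ℓ} {P : A → Set ℓ} (P? : Decidable P) xs →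
                      length (filter P? xs) ≡ count (does ∘ P?) xs
length-filter≡count P? []       = refl
length-filter≡count P? (x ∷ xs) with does (P? x)
... | true  = cong suc (length-filter≡count P? xs)
... | false = length-filter≡count P? xs

Violation : ∀ {v w} (γn γd βn βd : ℕ) → BipGraph v w → Subset v → Set
Violation {v} γn γd βn βd G Y =
  γd * ∣ Y ∣ ≤ γn * v × ¬ (βn * ∣ Y ∣ ≤ βd * ∣ Nbhd G Y ∣)

violation? : ∀ {v w} (γn γd βn βd : ℕ) (G : BipGraph v w) → Decidable (Violation γn γd βn βd G)
violation? {v} γn γd βn βd G Y =
  (γd * ∣ Y ∣ ≤? γn * v) ×-dec ¬? (βn * ∣ Y ∣ ≤? βd * ∣ Nbhd G Y ∣)

no-violation⇒expander : ∀ {v w} {γn γd βn βd : ℕ} {G : BipGraph v w} →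
  w ≤ v → ¬ ∃ (Violation γn γd βn βd G) → IsExpander γn γd βn βd G
no-violation⇒expander w≤v none =
  w≤v , λ Y small → decidable-stable (_ ≤? _) (λ not-expanding → none (Y , small , not-expanding))

eight-ninths : ∀ {g b M} → b + g ≡ M → 9 * b ≤ M → 8 * M ≤ 9 * g
eight-ninths {g} {b} {M} b+g≡M 9b≤M = +-cancelʳ-≤ b (8 * M) (9 * g) (begin
  8 * M + b          ≡⟨ cong (λ x → 8 * x + b) b+g≡M ⟨
  8 * (b + g) + b    ≡⟨ expand b g ⟩
  8 * g + 9 * b      ≤⟨ +-monoʳ-≤ (8 * g) 9b≤M ⟩
  8 * g + M          ≡⟨ cong (8 * g +_) b+g≡M ⟨
  8 * g + (b + g)    ≡⟨ regroup b g ⟩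
  9 * g + b          ∎)
  where
  open ≤-Reasoning
  expand : ∀ b g → 8 * (b + g) + b ≡ 8 * g + 9 * b
  expand = solve-∀
  regroup : ∀ b g → 8 * g + (b + g) ≡ 9 * g + b
  regroup = solve-∀

module RandomGraph (n r : ℕ) where

  Choices : List (Subset n)
  Choices = subsetsOfSize n r

  D : ℕ
  D = length Choices

  graphs : List (BipGraph n n)
  graphs = vectors Choices n

  Bad : BipGraph n n → Set
  Bad G = ∃ (Violation 1 (10 * r) r 2 G)

  bad? : Decidable Bad
  bad? G = anySubset? (violation? 1 (10 * r) r 2 G)

  -- A violating set of size s has |N(Y)| ≤ t(s), with 2t(s) < rs ≤ 2t(s) + 2.
  t : ℕ → ℕ
  t s = ⌊ (r * s ∸ 1) /2⌋

  pairs : ℕ → List (Subset n × Subset n)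
  pairs s with 10 * (r * s) ≤? n
  ... | yes _ = cartesianProduct (subsetsOfSize n s) (subsetsOfSize n (t s))
  ... | no  _ = []

  events : List (Subset n × Subset n)
  events = concatMap pairs (range 1 n)

  Nbhd⊆ : Subset n × Subset n → BipGraph n n → Bool
  Nbhd⊆ (Y , T) G = Nbhd G Y ⊆ᵇ T

  -- Every bad graph lies in one of the events: for a violating Y with
  -- |Y| = s, 2|N(Y)| < rs, so N(Y) ⊆ T for some t(s)-set T.
  bad-covered : ∀ G → does (bad? G) ≡ true → ∃[ i ] (i ∈ events × Nbhd⊆ i G ≡ true)
  bad-covered G bad with bad? G
  bad-covered G () | no _
  bad-covered G _  | yes (Y , 10rs≤n , not-expanding) =
    (Y , T) , ∈-concat⁺′ Y,T∈pairs (∈-map⁺ pairs s∈range) , N⊆T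
    where
    s N : ℕ
    s = ∣ Y ∣
    N = ∣ Nbhd G Y ∣
    2N<rs : 2 * N < r * s
    2N<rs = ≰⇒> not-expanding
    1≤s : 1 ≤ s
    1≤s = n≢0⇒n>0 λ s≡0 →
      <⇒≱ 2N<rs (subst (_≤ 2 * N) (sym (trans (cong (r *_) s≡0) (*-zeroʳ r))) z≤n)
    s∈range : s ∈ range 1 n
    s∈range = ∈-range n 1≤s (s≤s (∣p∣≤n Y))
    10rs≤n′ : 10 * (r * s) ≤ n
    10rs≤n′ = subst₂ _≤_ (*-assoc 10 r s) (*-identityˡ n) 10rs≤n
    N≤t : N ≤ t s
    N≤t = double<⇒≤half-pred 2N<rs
    t≤n : t s ≤ n
    t≤n = ≤-trans (⌊n/2⌋≤n (r * s ∸ 1))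
            (≤-trans (m∸n≤m (r * s) 1) (≤-trans (m≤n*m (r * s) 10) 10rs≤n′))
    extension : ∃[ T ] (Nbhd G Y ⊆ᵇ T ≡ true × ∣ T ∣ ≡ t s)
    extension = extend (Nbhd G Y) N≤t t≤n
    T : Subset n
    T = proj₁ extension
    N⊆T : Nbhd G Y ⊆ᵇ T ≡ true
    N⊆T = proj₁ (proj₂ extension)
    Y,T∈pairs : (Y , T) ∈ pairs s
    Y,T∈pairs with 10 * (r * s) ≤? n
    ... | yes _  = ∈-cartesianProduct⁺ (∈-subsetsOfSize Y)
                     (subst (T ∈_) (cong (subsetsOfSize n) (proj₂ (proj₂ extension)))
                            (∈-subsetsOfSize T))
    ... | no big = contradiction 10rs≤n′ big

  event-count : Subset n × Subset n → ℕ
  event-count i = count (Nbhd⊆ i) graphs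

  incidences : ℕ → ℕ
  incidences s = sum (map event-count (pairs s))

  D≡binom : D ≡ binom n r
  D≡binom = length-subsetsOfSize n r

  event-count≡ : ∀ {s t′ Y T} → Y ∈ subsetsOfSize n s → T ∈ subsetsOfSize n t′ →
                 D ^ s * event-count (Y , T) ≡ binom t′ r ^ s * D ^ n
  event-count≡ {s} {t′} {Y} {T} Y∈ T∈ = begin
    D ^ s * event-count (Y , T)
      ≡⟨ *-comm (D ^ s) _ ⟩
    event-count (Y , T) * D ^ s
      ≡⟨ cong (λ k → event-count (Y , T) * D ^ k) ∣Y∣≡s ⟨
    event-count (Y , T) * D ^ ∣ Y ∣
      ≡⟨ count-Nbhd⊆ Choices T n Y ⟩
    count (_⊆ᵇ T) Choices ^ ∣ Y ∣ * D ^ n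
      ≡⟨ cong₂ (λ c k → c ^ k * D ^ n) (count-⊆ᵇ n r T) ∣Y∣≡s ⟩
    binom ∣ T ∣ r ^ s * D ^ n
      ≡⟨ cong (λ k → binom k r ^ s * D ^ n) ∣T∣≡t ⟩
    binom t′ r ^ s * D ^ n
      ∎
    where
    open ≡-Reasoning
    ∣Y∣≡s : ∣ Y ∣ ≡ s
    ∣Y∣≡s = List.lookup (size-subsetsOfSize n s) Y∈
    ∣T∣≡t : ∣ T ∣ ≡ t′
    ∣T∣≡t = List.lookup (size-subsetsOfSize n t′) T∈

  -- Events with |Y| = s and |T| = t′ all have the same count, so their
  -- total is exact.
  sum-events : ∀ s t′ →
    D ^ s * sum (map event-count (cartesianProduct (subsetsOfSize n s) (subsetsOfSize n t′)))
      ≡ binom n s * binom n t′ * (binom t′ r ^ s * D ^ n)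
  sum-events s t′ = begin
    D ^ s * sum (map event-count P)
      ≡⟨ sum-map-*ˡ (D ^ s) event-count P ⟩
    sum (map (λ i → D ^ s * event-count i) P)
      ≡⟨ sum-map-const _ _ P each-event ⟩
    length P * (binom t′ r ^ s * D ^ n)
      ≡⟨ cong (_* (binom t′ r ^ s * D ^ n)) length-P ⟩
    binom n s * binom n t′ * (binom t′ r ^ s * D ^ n)
      ∎
    where
    open ≡-Reasoning
    P : List (Subset n × Subset n)
    P = cartesianProduct (subsetsOfSize n s) (subsetsOfSize n t′)
    each-event : ∀ {i} → i ∈ P → D ^ s * event-count i ≡ binom t′ r ^ s * D ^ n
    each-event i∈P = let (Y∈ , T∈) = ∈-cartesianProduct⁻ _ _ i∈P in event-count≡ Y∈ T∈
    length-P : length P ≡ binom n s * binom n t′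
    length-P = trans (length-cartesianProductWith _,_ (subsetsOfSize n s) (subsetsOfSize n t′))
                     (cong₂ _*_ (length-subsetsOfSize n s) (length-subsetsOfSize n t′))

  incidences-bound : 12 ≤ r → r ≤ n → ∀ s → 1 ≤ s → 2 ^ s * (9 * incidences s) ≤ D ^ n
  incidences-bound 12≤r r≤n s 1≤s with 10 * (r * s) ≤? n
  ... | no _        = subst (_≤ D ^ n) (sym (*-zeroʳ (2 ^ s))) z≤n
  ... | yes 10rs≤n  = *-cancelʳ-≤ _ _ (D ^ s) {{m^n≢0 D s {{D-nonZero}}}} (begin
    2 ^ s * (9 * Z) * D ^ s
      ≡⟨ regroup (2 ^ s) Z (D ^ s) ⟩
    9 * 2 ^ s * (D ^ s * Z)
      ≡⟨ cong (9 * 2 ^ s *_) (sum-events s (t s)) ⟩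
    9 * 2 ^ s * (binom n s * binom n (t s) * (binom (t s) r ^ s * D ^ n))
      ≡⟨ regroup′ (2 ^ s) (binom n s) (binom n (t s)) (binom (t s) r ^ s) (D ^ n) ⟩
    9 * 2 ^ s * binom n s * binom n (t s) * binom (t s) r ^ s * D ^ n
      ≤⟨ *-monoˡ-≤ (D ^ n) (first-moment-bound 12≤r 1≤s 2t<rs rs≤2t+2 10rs≤n) ⟩
    binom n r ^ s * D ^ n
      ≡⟨ cong (λ d → d ^ s * D ^ n) D≡binom ⟨
    D ^ s * D ^ n
      ≡⟨ *-comm (D ^ s) (D ^ n) ⟩
    D ^ n * D ^ s
      ∎)
    where
    open ≤-Reasoning
    Z : ℕ
    Z = sum (map event-count (cartesianProduct (subsetsOfSize n s) (subsetsOfSize n (t s))))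
    regroup : ∀ a z d → a * (9 * z) * d ≡ 9 * a * (d * z)
    regroup = solve-∀
    regroup′ : ∀ a b c e f → 9 * a * (b * c * (e * f)) ≡ 9 * a * b * c * e * f
    regroup′ = solve-∀
    D-nonZero : NonZero D
    D-nonZero = >-nonZero (subst (1 ≤_) (sym D≡binom) (binom-pos r≤n))
    1≤rs : 1 ≤ r * s
    1≤rs = ≤-trans 1≤s (m≤n*m s r {{>-nonZero (≤-trans (s≤s z≤n) 12≤r)}})
    2t<rs : suc (2 * t s) ≤ r * s
    2t<rs = proj₁ (half-pred-bounds 1≤rs)
    rs≤2t+2 : r * s ≤ 2 * suc (t s)
    rs≤2t+2 = proj₂ (half-pred-bounds 1≤rs)

  -- Union bound plus geometric summation over s: at most a ninth of all
  -- graphs are bad.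
  bad-count-bound : 12 ≤ r → r ≤ n → 9 * count (does ∘ bad?) graphs ≤ D ^ n
  bad-count-bound 12≤r r≤n = begin
    9 * count (does ∘ bad?) graphs
      ≤⟨ *-monoʳ-≤ 9 (union-bound (does ∘ bad?) Nbhd⊆ events bad-covered graphs) ⟩
    9 * sum (map event-count events)
      ≡⟨ cong (9 *_) (sum-concatMap event-count pairs (range 1 n)) ⟩
    9 * sum (map incidences (range 1 n))
      ≡⟨ sum-map-*ˡ 9 incidences (range 1 n) ⟩
    sum (map (λ s → 9 * incidences s) (range 1 n))
      ≤⟨ *-cancelˡ-≤ 2 (geometric-sum (λ s → 9 * incidences s) (D ^ n) 1 n
                                       (incidences-bound 12≤r r≤n)) ⟩
    D ^ n
      ∎
    where open ≤-Reasoning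

  expanders : List (BipGraph n n)
  expanders = filter (¬? ∘ bad?) graphs

  expanders-suffice : 12 ≤ r → r ≤ n → ProbExpanderAtLeast n r 1 (10 * r) r 2 8 9
  expanders-suffice 12≤r r≤n = expanders , unique-expanders , regular-expanders , proportion
    where
    unique-expanders : Unique expanders
    unique-expanders = Unique.filter⁺ (¬? ∘ bad?) (unique-vectors n (unique-subsetsOfSize n r))
    regular-expanders : List.All (λ G → RegularLeft r G × IsExpander 1 (10 * r) r 2 G) expanders
    regular-expanders = List.zipWith
      (λ {G} (regular , good) →
         regular , no-violation⇒expander {γn = 1} {10 * r} {r} {2} {G} ≤-refl good)
      (List.filter⁺ (¬? ∘ bad?) (all-vectors n (size-subsetsOfSize n r)) ,
       List.all-filter (¬? ∘ bad?) graphs)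
    good+bad : count (does ∘ bad?) graphs + count (not ∘ does ∘ bad?) graphs ≡ D ^ n
    good+bad = trans (count+count-not (does ∘ bad?) graphs) (length-vectors Choices n)
    proportion : 8 * (n C r) ^ n ≤ 9 * length expanders
    proportion = subst₂ (λ d g → 8 * d ^ n ≤ 9 * g) (trans D≡binom (binom≡C n r))
                        (sym (length-filter≡count (¬? ∘ bad?) graphs))
                        (eight-ninths {g = count (not ∘ does ∘ bad?) graphs} good+bad
                                      (bad-count-bound 12≤r r≤n))

lemma10 : ∃[ r₁ ] (∀ (r n : ℕ) → r₁ ≤ r → 10 ≤ r → 4 * r ≤ n →
            ProbExpanderAtLeast n r 1 (10 * r) r 2 8 9)
lemma10 = 12 , λ r n 12≤r _ 4r≤n →
  RandomGraph.expanders-suffice n r 12≤r (≤-trans (m≤n*m r 4) 4r≤n)
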